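{- Let $m\ge 2$ be an integer and $n$ a positive integer. The number of partitions of $n$ whose smallest part appears fewer than $m$ times and in which every part divisible by $m$ is at most $m$ times the smallest part equals the number of partitions of $n$ in which every part appears fewer than $m$ times. -}

module Defs where

open import Data.Nat using (ℕ; zero; suc; _≤_; _≥_; _<_; _⊓_; _*_)
open import Data.Nat.Divisibility using (_∣_; _∣?_)
open import Data.List using (List; []; _∷_; length; filter)
open import Data.Nat.ListAction using (sum)
open import Data.List.Relation.Unary.All using (All)
open import Data.List.Relation.Unary.Linked using (Linked)
open import Data.List.Membership.Propositional using (_∈_)
open import Data.Nat.Properties using (_≟_)
open import Data.Product using (Σ; _×_)
open import Relation.Binary.PropositionalEquality using (_≡_)

IsPartition : ℕ → List ℕ → Set
IsPartition n λs = All (λ k → 1 ≤ k) λs × Linked _≥_ λs × sum λs ≡ n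

Partition : ℕ → Set
Partition n = Σ (List ℕ) (IsPartition n)

multiplicity : ℕ → List ℕ → ℕ
multiplicity k λs = length (filter (_≟ k) λs)

-- smallest part (0 for the empty list; partitions of n ≥ 1 are nonempty)
smallestPart : List ℕ → ℕ
smallestPart [] = 0
smallestPart (x ∷ []) = x
smallestPart (x ∷ y ∷ xs) = x ⊓ smallestPart (y ∷ xs)

LeftCondition : ℕ → List ℕ → Set
LeftCondition m λs =
  multiplicity (smallestPart λs) λs < m ×
  All (λ k → k ≤ m * smallestPart λs) (filter (m ∣?_) λs)

RightCondition : ℕ → List ℕ → Set
RightCondition m λs = All (λ k → multiplicity k λs < m) λs

-- Describe a partition by its multiplicity function and fix its smallest part s. Call a
-- part forbidden if it is divisible by m and exceeds m s, i.e. if it is m j with j > s.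
-- Every k is mᵈ r with r not forbidden, and if r > s then m r, m² r, … are all forbidden.
-- On the left, parts below s are absent, s occurs fewer than m times, forbidden parts are
-- absent and every other r > s occurs any number a r of times; on the right every part
-- occurs fewer than m times. The bijection keeps the parts up to s and replaces the a r
-- copies of such an r by mᵈ r taken as often as the d-th base-m digit of a r, which does
-- not change the sum. Its inverse collects a r = Σ_d b (mᵈ r) · mᵈ; this is additive in
-- b and turns a single part mᵈ r into mᵈ copies of r, whence it preserves the sum.

module Submission where

open import Defs
open import Data.Nat using (ℕ; zero; suc; _+_; _*_; _^_; _≤_; _<_; _≥_; z≤n; s≤s; z<s; NonZero; >-nonZero)
open import Data.Nat.Properties
open import Data.Nat.DivMod
open import Data.Nat.Divisibility using (_∣_; _∣?_; m∣m*n)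
open import Data.Nat.Induction using (<-wellFounded)
open import Data.Nat.ListAction using (sum)
open import Data.Nat.ListAction.Properties using (sum-++)
open import Data.Nat.Tactic.RingSolver using (solve-∀)
open import Data.List using (List; []; _∷_; [_]; length; filter; replicate; _++_)
open import Data.List.Properties using (filter-++; filter-all; filter-none; filter-some; length-++; length-replicate)
open import Data.List.Relation.Unary.All as All using (All; []; _∷_)
open import Data.List.Relation.Unary.All.Properties using (replicate⁺; ++⁺)
open import Data.List.Relation.Unary.Any as Any using (here; there)
open import Data.List.Relation.Unary.Linked as Linked using (Linked; []; [-]; _∷_)
open import Data.List.Relation.Unary.Linked.Properties using (Linked⇒All)
open import Data.List.Membership.Propositional using (_∈_; _∉_)
open import Data.List.Membership.Propositional.Properties using (∈-filter⁺; ∈-filter⁻)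
open import Data.List.Membership.DecPropositional _≟_ using (_∈?_)
open import Data.Product using (Σ; _×_; _,_; proj₁; proj₂; map₂)
open import Data.Sum using (_⊎_; inj₁; inj₂)
open import Function using (_∘_)
open import Function.Bundles using (_↔_; mk↔ₛ′)
open import Induction.WellFounded using (Acc; acc)
open import Relation.Nullary using (¬_; yes; no; contradiction; Irrelevant)
open import Relation.Nullary.Decidable using (_×-dec_)
open import Relation.Unary using (Decidable)
open import Relation.Binary.PropositionalEquality hiding ([_])

-- Multiplicity functions

multiplicity-++ : ∀ k xs ys → multiplicity k (xs ++ ys) ≡ multiplicity k xs + multiplicity k ys
multiplicity-++ k xs ys = trans (cong length (filter-++ (_≟ k) xs ys)) (length-++ (filter (_≟ k) xs))

multiplicity-replicate : ∀ c k → multiplicity k (replicate c k) ≡ c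
multiplicity-replicate c k = trans (cong length (filter-all (_≟ k) (replicate⁺ c refl))) (length-replicate c)

multiplicities : List ℕ → ℕ → ℕ
multiplicities xs k = multiplicity k xs

multiplicity-absent : ∀ {k} xs → All (_≢ k) xs → multiplicity k xs ≡ 0
multiplicity-absent {k} xs ≢k = cong length (filter-none (_≟ k) ≢k)

multiplicity-∉ : ∀ {k} xs → k ∉ xs → multiplicity k xs ≡ 0
multiplicity-∉ xs k∉xs =
  multiplicity-absent xs (All.tabulate λ x∈xs x≡k → k∉xs (subst (_∈ xs) x≡k x∈xs))

multiplicity≢0⇒∈ : ∀ {k} xs → multiplicity k xs ≢ 0 → k ∈ xs
multiplicity≢0⇒∈ {k} xs ≢0 with k ∈? xs
... | yes k∈xs = k∈xs
... | no k∉xs = contradiction (multiplicity-∉ xs k∉xs) ≢0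

∈⇒multiplicity≢0 : ∀ {k xs} → k ∈ xs → multiplicity k xs ≢ 0
∈⇒multiplicity≢0 {k} k∈xs = n>0⇒n≢0 (filter-some (_≟ k) (Any.map sym k∈xs))

fromMultiplicities : ℕ → (ℕ → ℕ) → List ℕ
fromMultiplicities zero f = []
fromMultiplicities (suc K) f = replicate (f (suc K)) (suc K) ++ fromMultiplicities K f

weight : ℕ → (ℕ → ℕ) → ℕ
weight zero f = 0
weight (suc K) f = f (suc K) * suc K + weight K f

PartsIn : ℕ → List ℕ → Set
PartsIn K = All (λ k → 1 ≤ k × k ≤ K)

multiplicity-outside : ∀ {K k} xs → PartsIn K xs → ¬ (1 ≤ k × k ≤ K) → multiplicity k xs ≡ 0
multiplicity-outside xs inK k∉ = multiplicity-absent xs (All.map (λ x∈ x≡k → k∉ (subst _ x≡k x∈)) inK)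

fromMultiplicities-partsIn : ∀ K f → PartsIn K (fromMultiplicities K f)
fromMultiplicities-partsIn zero f = []
fromMultiplicities-partsIn (suc K) f = ++⁺ (replicate⁺ (f (suc K)) (s≤s z≤n , ≤-refl))
  (All.map (map₂ m≤n⇒m≤1+n) (fromMultiplicities-partsIn K f))

≥-cons : ∀ {x xs} → All (_≤ x) xs → Linked _≥_ xs → Linked _≥_ (x ∷ xs)
≥-cons [] _ = [-]
≥-cons (y≤x ∷ _) sorted = y≤x ∷ sorted

fromMultiplicities-sorted : ∀ K f → Linked _≥_ (fromMultiplicities K f)
fromMultiplicities-sorted zero f = []
fromMultiplicities-sorted (suc K) f = prepend (f (suc K))
  where
  prepend : ∀ c → Linked _≥_ (replicate c (suc K) ++ fromMultiplicities K f)
  prepend zero = fromMultiplicities-sorted K f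
  prepend (suc c) = ≥-cons (++⁺ (replicate⁺ c ≤-refl)
    (All.map (m≤n⇒m≤1+n ∘ proj₂) (fromMultiplicities-partsIn K f))) (prepend c)

sum-replicate : ∀ c x → sum (replicate c x) ≡ c * x
sum-replicate zero x = refl
sum-replicate (suc c) x = cong (x +_) (sum-replicate c x)

sum-fromMultiplicities : ∀ K f → sum (fromMultiplicities K f) ≡ weight K f
sum-fromMultiplicities zero f = refl
sum-fromMultiplicities (suc K) f = trans (sum-++ (replicate (f (suc K)) (suc K)) _)
  (cong₂ _+_ (sum-replicate (f (suc K)) (suc K)) (sum-fromMultiplicities K f))

fromMultiplicities-isPartition : ∀ K f → IsPartition (weight K f) (fromMultiplicities K f)
fromMultiplicities-isPartition K f = All.map proj₁ (fromMultiplicities-partsIn K f)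
  , fromMultiplicities-sorted K f , sum-fromMultiplicities K f

fromMultiplicities-cong : ∀ K {f g} → (∀ k → k ≤ K → f k ≡ g k) →
  fromMultiplicities K f ≡ fromMultiplicities K g
fromMultiplicities-cong zero f≡g = refl
fromMultiplicities-cong (suc K) f≡g = cong₂ (λ c rest → replicate c (suc K) ++ rest)
  (f≡g (suc K) ≤-refl) (fromMultiplicities-cong K (λ k k≤K → f≡g k (m≤n⇒m≤1+n k≤K)))

multiplicity-fromMultiplicities-in : ∀ K f {k} → 1 ≤ k → k ≤ K →
  multiplicity k (fromMultiplicities K f) ≡ f k
multiplicity-fromMultiplicities-in zero f (s≤s _) ()
multiplicity-fromMultiplicities-in (suc K) f {k} 1≤k k≤1+K =
  trans (multiplicity-++ k (replicate (f (suc K)) (suc K)) (fromMultiplicities K f))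
    (byPosition (m≤n⇒m<n∨m≡n k≤1+K))
  where
  byPosition : k < suc K ⊎ k ≡ suc K →
    multiplicity k (replicate (f (suc K)) (suc K)) + multiplicity k (fromMultiplicities K f) ≡ f k
  byPosition (inj₁ (s≤s k≤K)) = cong₂ _+_
    (multiplicity-absent _ (replicate⁺ (f (suc K)) (>⇒≢ (s≤s k≤K))))
    (multiplicity-fromMultiplicities-in K f 1≤k k≤K)
  byPosition (inj₂ refl) = trans (cong₂ _+_ (multiplicity-replicate (f k) k)
    (multiplicity-outside _ (fromMultiplicities-partsIn K f) (λ (_ , k≤K) → 1+n≰n k≤K))) (+-identityʳ (f k))

multiplicities-fromMultiplicities : ∀ K f → f 0 ≡ 0 → (∀ k → K < k → f k ≡ 0) →
  multiplicities (fromMultiplicities K f) ≗ f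
multiplicities-fromMultiplicities K f f0≡0 f-above zero =
  trans (multiplicity-outside _ (fromMultiplicities-partsIn K f) (λ ())) (sym f0≡0)
multiplicities-fromMultiplicities K f f0≡0 f-above (suc k) with suc k ≤? K
... | yes k≤K = multiplicity-fromMultiplicities-in K f (s≤s z≤n) k≤K
... | no k≰K = trans (multiplicity-outside _ (fromMultiplicities-partsIn K f) (k≰K ∘ proj₂))
  (sym (f-above (suc k) (≰⇒> k≰K)))

fromMultiplicities-zero : ∀ K → fromMultiplicities K (λ _ → 0) ≡ []
fromMultiplicities-zero zero = refl
fromMultiplicities-zero (suc K) = fromMultiplicities-zero K

multiplicity-[-]-≢ : ∀ {x k} → x ≢ k → multiplicity k [ x ] ≡ 0
multiplicity-[-]-≢ x≢k = multiplicity-absent _ (x≢k ∷ [])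

fromMultiplicities-insert : ∀ K {x} g → 1 ≤ x → x ≤ K → (∀ k → x < k → g k ≡ 0) →
  fromMultiplicities K (λ k → multiplicity k [ x ] + g k) ≡ x ∷ fromMultiplicities K g
fromMultiplicities-insert zero g (s≤s _) ()
fromMultiplicities-insert (suc K) {x} g 1≤x x≤1+K g-above with m≤n⇒m<n∨m≡n x≤1+K
... | inj₂ refl = cong₂ (λ c rest → replicate c x ++ rest) (cong (_+ g x) (multiplicity-replicate 1 x))
  (fromMultiplicities-cong K λ k k≤K → cong (_+ g k) (multiplicity-[-]-≢ (>⇒≢ (s≤s k≤K))))
... | inj₁ (s≤s x≤K) = begin
  replicate (multiplicity (suc K) [ x ] + g (suc K)) (suc K)
    ++ fromMultiplicities K (λ k → multiplicity k [ x ] + g k)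
    ≡⟨ cong₂ (λ c rest → replicate c (suc K) ++ rest)
         (cong₂ _+_ (multiplicity-[-]-≢ (<⇒≢ (s≤s x≤K))) (g-above (suc K) (s≤s x≤K)))
         (fromMultiplicities-insert K g 1≤x x≤K g-above) ⟩
  x ∷ fromMultiplicities K g
    ≡⟨ cong (λ c → x ∷ (replicate c (suc K) ++ fromMultiplicities K g)) (g-above (suc K) (s≤s x≤K)) ⟨
  x ∷ (replicate (g (suc K)) (suc K) ++ fromMultiplicities K g) ∎
  where open ≡-Reasoning

fromMultiplicities-multiplicities : ∀ K xs → Linked _≥_ xs → PartsIn K xs →
  fromMultiplicities K (multiplicities xs) ≡ xs
fromMultiplicities-multiplicities K [] _ _ = fromMultiplicities-zero K
fromMultiplicities-multiplicities K (x ∷ xs) sorted ((1≤x , x≤K) ∷ inK) = begin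
  fromMultiplicities K (multiplicities (x ∷ xs))
    ≡⟨ fromMultiplicities-cong K (λ k _ → multiplicity-++ k [ x ] xs) ⟩
  fromMultiplicities K (λ k → multiplicity k [ x ] + multiplicity k xs)
    ≡⟨ fromMultiplicities-insert K _ 1≤x x≤K xs-above-x ⟩
  x ∷ fromMultiplicities K (multiplicities xs)
    ≡⟨ cong (x ∷_) (fromMultiplicities-multiplicities K xs (Linked.tail sorted) inK) ⟩
  x ∷ xs ∎
  where
  open ≡-Reasoning
  xs-above-x : ∀ k → x < k → multiplicity k xs ≡ 0
  xs-above-x k x<k = multiplicity-absent xs (All.map (λ y≤x → <⇒≢ (≤-<-trans y≤x x<k))
    (All.tail (Linked⇒All (λ j≤i k≤j → ≤-trans k≤j j≤i) ≤-refl sorted)))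

weight-multiplicities : ∀ K xs → Linked _≥_ xs → PartsIn K xs → weight K (multiplicities xs) ≡ sum xs
weight-multiplicities K xs sorted inK = trans (sym (sum-fromMultiplicities K _))
  (cong sum (fromMultiplicities-multiplicities K xs sorted inK))

weight-cong : ∀ K {f g} → f ≗ g → weight K f ≡ weight K g
weight-cong zero f≗g = refl
weight-cong (suc K) f≗g = cong₂ (λ c rest → c * suc K + rest) (f≗g (suc K)) (weight-cong K f≗g)

weight-zero : ∀ K → weight K (λ _ → 0) ≡ 0
weight-zero zero = refl
weight-zero (suc K) = weight-zero K

weight-+ : ∀ K f g → weight K (λ k → f k + g k) ≡ weight K f + weight K g
weight-+ zero f g = refl
weight-+ (suc K) f g = trans (cong ((f (suc K) + g (suc K)) * suc K +_) (weight-+ K f g))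
  (interchange (f (suc K)) (g (suc K)) (suc K) (weight K f) (weight K g))
  where
  interchange : ∀ a b k x y → (a + b) * k + (x + y) ≡ (a * k + x) + (b * k + y)
  interchange = solve-∀

weight-* : ∀ K c f → weight K (λ k → c * f k) ≡ c * weight K f
weight-* zero c f = sym (*-zeroʳ c)
weight-* (suc K) c f = begin
  c * f (suc K) * suc K + weight K (λ k → c * f k) ≡⟨ cong₂ _+_ (*-assoc c _ _) (weight-* K c f) ⟩
  c * (f (suc K) * suc K) + c * weight K f          ≡⟨ *-distribˡ-+ c _ _ ⟨
  c * (f (suc K) * suc K + weight K f) ∎
  where open ≡-Reasoning

term≤weight : ∀ K f {k} → 1 ≤ k → k ≤ K → f k * k ≤ weight K f
term≤weight zero f (s≤s _) ()
term≤weight (suc K) f {k} 1≤k k≤1+K with m≤n⇒m<n∨m≡n k≤1+K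
... | inj₂ refl = m≤m+n (f k * k) (weight K f)
... | inj₁ (s≤s k≤K) = ≤-trans (term≤weight K f 1≤k k≤K) (m≤n+m (weight K f) _)

weight-single : ∀ K {i} → 1 ≤ i → i ≤ K → weight K (multiplicities [ i ]) ≡ i
weight-single K 1≤i i≤K = trans (weight-multiplicities K [ _ ] [-] ((1≤i , i≤K) ∷ [])) (+-identityʳ _)

-- Partitions and their multiplicity functions

∈⇒≤sum : ∀ {k xs} → k ∈ xs → k ≤ sum xs
∈⇒≤sum {xs = x ∷ xs} (here refl) = m≤m+n x (sum xs)
∈⇒≤sum {xs = x ∷ xs} (there k∈xs) = ≤-trans (∈⇒≤sum k∈xs) (m≤n+m (sum xs) x)

partition-partsIn : ∀ {n xs} → IsPartition n xs → PartsIn n xs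
partition-partsIn (positive , _ , refl) = All.tabulate λ k∈xs → All.lookup positive k∈xs , ∈⇒≤sum k∈xs

isPartition-irrelevant : ∀ {n xs} → Irrelevant (IsPartition n xs)
isPartition-irrelevant (p , l , e) (p′ , l′ , e′) =
  cong₂ _,_ (All.irrelevant ≤-irrelevant p p′)
    (cong₂ _,_ (Linked.irrelevant ≤-irrelevant l l′) (≡-irrelevant e e′))

smallestPart-∈ : ∀ x xs → smallestPart (x ∷ xs) ∈ x ∷ xs
smallestPart-∈ x [] = here refl
smallestPart-∈ x (y ∷ ys) with ⊓-sel x (smallestPart (y ∷ ys))
... | inj₁ x⊓≡x = here x⊓≡x
... | inj₂ x⊓≡sp = there (subst (_∈ y ∷ ys) (sym x⊓≡sp) (smallestPart-∈ y ys))

smallestPart-≤ : ∀ x xs → All (smallestPart (x ∷ xs) ≤_) (x ∷ xs)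
smallestPart-≤ x [] = ≤-refl ∷ []
smallestPart-≤ x (y ∷ ys) = m⊓n≤m x _ ∷ All.map (≤-trans (m⊓n≤n x _)) (smallestPart-≤ y ys)

smallestPart-unique : ∀ {k xs} → k ∈ xs → All (k ≤_) xs → smallestPart xs ≡ k
smallestPart-unique {xs = x ∷ xs} k∈xs k≤xs =
  ≤-antisym (All.lookup (smallestPart-≤ x xs) k∈xs) (All.lookup k≤xs (smallestPart-∈ x xs))

record IsPartitionMultiplicities (n s : ℕ) (f : ℕ → ℕ) : Set where
  field
    1≤s : 1 ≤ s
    vanishing-below : ∀ k → k < s → f k ≡ 0
    smallest≢0 : f s ≢ 0
    vanishing-above : ∀ k → n < k → f k ≡ 0
    weight≡n : weight n f ≡ n

  bounded-≤s : ∀ {c} → f s < c → ∀ k → k ≤ s → f k < c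
  bounded-≤s fs<c k k≤s with m≤n⇒m<n∨m≡n k≤s
  ... | inj₁ k<s = subst (_< _) (sym (vanishing-below k k<s)) (≤-<-trans z≤n fs<c)
  ... | inj₂ refl = fs<c

  vanishing-0 : f 0 ≡ 0
  vanishing-0 = vanishing-below 0 1≤s

  *-bounded : ∀ k → k * f k ≤ n
  *-bounded zero = z≤n
  *-bounded (suc k) with suc k ≤? n
  ... | yes k≤n = subst₂ _≤_ (*-comm (f (suc k)) (suc k)) weight≡n (term≤weight n f (s≤s z≤n) k≤n)
  ... | no k≰n = subst (_≤ n)
    (sym (trans (cong (suc k *_) (vanishing-above (suc k) (≰⇒> k≰n))) (*-zeroʳ (suc k)))) z≤n

  multiplicities-≗ : multiplicities (fromMultiplicities n f) ≗ f
  multiplicities-≗ = multiplicities-fromMultiplicities n f vanishing-0 vanishing-above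

  isPartition : IsPartition n (fromMultiplicities n f)
  isPartition = subst (λ w → IsPartition w (fromMultiplicities n f)) weight≡n
    (fromMultiplicities-isPartition n f)

  smallestPart-≡ : smallestPart (fromMultiplicities n f) ≡ s
  smallestPart-≡ = smallestPart-unique {xs = fromMultiplicities n f}
    (multiplicity≢0⇒∈ _ (smallest≢0 ∘ trans (sym (multiplicities-≗ s))))
    (All.tabulate λ {k} k∈ → ≮⇒≥ λ k<s →
      ∈⇒multiplicity≢0 k∈ (trans (multiplicities-≗ k) (vanishing-below k k<s)))

partition-multiplicities : ∀ {n xs} → 1 ≤ n → IsPartition n xs →
  IsPartitionMultiplicities n (smallestPart xs) (multiplicities xs)
partition-multiplicities {xs = []} 1≤n (_ , _ , refl) = contradiction 1≤n λ ()
partition-multiplicities {n} {x ∷ xs} _ isP@(positive , sorted , sum≡n) = record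
  { 1≤s = All.lookup positive s∈
  ; vanishing-below = λ k k<s →
      multiplicity-∉ (x ∷ xs) λ k∈ → <⇒≱ k<s (All.lookup (smallestPart-≤ x xs) k∈)
  ; smallest≢0 = ∈⇒multiplicity≢0 s∈
  ; vanishing-above = λ k n<k → multiplicity-∉ (x ∷ xs) λ k∈ → <⇒≱ n<k (proj₂ (All.lookup inN k∈))
  ; weight≡n = trans (weight-multiplicities n (x ∷ xs) sorted inN) sum≡n
  }
  where
  s∈ = smallestPart-∈ x xs
  inN = partition-partsIn isP

partition-fromMultiplicities-multiplicities : ∀ {n xs} → IsPartition n xs →
  fromMultiplicities n (multiplicities xs) ≡ xs
partition-fromMultiplicities-multiplicities isP@(_ , sorted , _) =
  fromMultiplicities-multiplicities _ _ sorted (partition-partsIn isP)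

partitionClasses-↔ : ∀ {n} {L R : List ℕ → Set} →
  (∀ xs → Irrelevant (L xs)) → (∀ xs → Irrelevant (R xs)) →
  (to from : List ℕ → List ℕ) →
  (∀ {xs} → IsPartition n xs → L xs → IsPartition n (to xs) × R (to xs)) →
  (∀ {ys} → IsPartition n ys → R ys → IsPartition n (from ys) × L (from ys)) →
  (∀ {xs} → IsPartition n xs → L xs → from (to xs) ≡ xs) →
  (∀ {ys} → IsPartition n ys → R ys → to (from ys) ≡ ys) →
  Σ (Partition n) (λ p → L (proj₁ p)) ↔ Σ (Partition n) (λ p → R (proj₁ p))
partitionClasses-↔ {n} L-irr R-irr to from to-ok from-ok from∘to to∘from = mk↔ₛ′
  (λ ((xs , isP) , l) → (to xs , proj₁ (to-ok isP l)) , proj₂ (to-ok isP l))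
  (λ ((ys , isP) , r) → (from ys , proj₁ (from-ok isP r)) , proj₂ (from-ok isP r))
  (λ ((ys , isP) , r) → ≡-member R-irr (to∘from isP r))
  (λ ((xs , isP) , l) → ≡-member L-irr (from∘to isP l))
  where
  ≡-member : ∀ {C : List ℕ → Set} → (∀ xs → Irrelevant (C xs)) → ∀ {xs ys p q c d} → xs ≡ ys →
    _≡_ {A = Σ (Partition n) (λ p → C (proj₁ p))} ((xs , p) , c) ((ys , q) , d)
  ≡-member C-irr {p = p} {q} {c} {d} refl =
    cong₂ (λ p c → (_ , p) , c) (isPartition-irrelevant p q) (C-irr _ c d)

leftCondition-irrelevant : ∀ m xs → Irrelevant (LeftCondition m xs)
leftCondition-irrelevant m xs (p , q) (p′ , q′) =
  cong₂ _,_ (<-irrelevant p p′) (All.irrelevant ≤-irrelevant q q′)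

rightCondition-irrelevant : ∀ m xs → Irrelevant (RightCondition m xs)
rightCondition-irrelevant m xs = All.irrelevant <-irrelevant

-- Base-m digits along the chains k, m k, m² k, …

module Glaisher (m : ℕ) (1<m : 1 < m) where

  0<m : 0 < m
  0<m = <-trans z<s 1<m

  instance
    m-nonZero : NonZero m
    m-nonZero = >-nonZero 0<m

  n<m^n : ∀ n → n < m ^ n
  n<m^n zero = z<s
  n<m^n (suc n) = begin-strict
    suc n             ≤⟨ n<m^n n ⟩
    m ^ n             <⟨ m<m*n (m ^ n) m 1<m ⟩
    m ^ n * m         ≡⟨ *-comm (m ^ n) m ⟩
    m ^ suc n         ∎
    where
    open ≤-Reasoning
    instance _ = m^n≢0 m n

  expand : (ℕ → ℕ) → ℕ → ℕ → ℕ
  expand b zero k = 0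
  expand b (suc f) k = b k + m * expand b f (m * k)

  expand-cong : ∀ {b c} → b ≗ c → ∀ f k → expand b f k ≡ expand c f k
  expand-cong b≗c zero k = refl
  expand-cong b≗c (suc f) k = cong₂ (λ x y → x + m * y) (b≗c k) (expand-cong b≗c f (m * k))

  expand-+ : ∀ b c f k → expand (λ j → b j + c j) f k ≡ expand b f k + expand c f k
  expand-+ b c zero k = refl
  expand-+ b c (suc f) k = trans (cong (λ x → b k + c k + m * x) (expand-+ b c f (m * k)))
    (interchange (b k) (c k) m (expand b f (m * k)) (expand c f (m * k)))
    where
    interchange : ∀ a b m x y → a + b + m * (x + y) ≡ (a + m * x) + (b + m * y)
    interchange = solve-∀

  expand-∘-* : ∀ b f k → expand b f (m * k) ≡ expand (b ∘ (m *_)) f k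
  expand-∘-* b zero k = refl
  expand-∘-* b (suc f) k = cong (λ x → b (m * k) + m * x) (expand-∘-* b f (m * k))

  expand-vanishing : ∀ {B b} → (∀ j → B < j → b j ≡ 0) → ∀ f {k} → B < k → expand b f k ≡ 0
  expand-vanishing b-above zero B<k = refl
  expand-vanishing {b = b} b-above (suc f) {k} B<k = begin
    b k + m * expand b f (m * k) ≡⟨ cong₂ (λ x y → x + m * y) (b-above k B<k)
                                    (expand-vanishing b-above f (<-≤-trans B<k (m≤n*m k m))) ⟩
    m * 0                        ≡⟨ *-zeroʳ m ⟩
    0 ∎
    where open ≡-Reasoning

  expand-stable : ∀ {N b} → (∀ j → N < j → b j ≡ 0) → ∀ f k → N < k * m ^ f →
    expand b (suc f) k ≡ expand b f k
  expand-stable b-above zero k N<k = expand-vanishing b-above 1 (subst (_ <_) (*-identityʳ k) N<k)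
  expand-stable {N} {b} b-above (suc f) k N<k = cong (λ x → b k + m * x)
    (expand-stable b-above f (m * k) (subst (N <_) (reassoc k m (m ^ f)) N<k))
    where
    reassoc : ∀ k m p → k * (m * p) ≡ m * k * p
    reassoc = solve-∀

  expand-saturated : ∀ {N b} → (∀ j → N < j → b j ≡ 0) → ∀ {k} → 1 ≤ k →
    expand b (suc N) k ≡ expand b N k
  expand-saturated {N} b-above {k} 1≤k =
    expand-stable b-above N k (<-≤-trans (n<m^n N) (m≤n*m (m ^ N) k {{>-nonZero 1≤k}}))

  m*j/m≡j : ∀ j → m * j / m ≡ j
  m*j/m≡j j = trans (cong (_/ m) (*-comm m j)) (m*n/n≡m j m)

  [c+m*x]/m≡x : ∀ {c} x → c < m → (c + m * x) / m ≡ x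
  [c+m*x]/m≡x {c} x c<m = trans (+-distrib-/-∣ʳ c (m∣m*n x)) (cong₂ _+_ (m<n⇒m/n≡0 c<m) (m*j/m≡j x))

  [c+m*x]%m≡c : ∀ {c} x → c < m → (c + m * x) % m ≡ c
  [c+m*x]%m≡c {c} x c<m = trans (cong (λ y → (c + y) % m) (*-comm m x))
    (trans ([m+kn]%n≡m%n c x m) (m<n⇒m%n≡m c<m))

  x%m+m*[x/m]≡x : ∀ x → x % m + m * (x / m) ≡ x
  x%m+m*[x/m]≡x x = trans (cong (x % m +_) (*-comm m (x / m))) (sym (m≡m%n+[m/n]*n x m))

  multiplicity-*-[*] : ∀ q x → multiplicities [ m * q ] (m * x) ≡ multiplicities [ q ] x
  multiplicity-*-[*] q x with q ≟ x
  ... | yes refl = trans (multiplicity-replicate 1 (m * q)) (sym (multiplicity-replicate 1 q))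
  ... | no q≢x = trans (multiplicity-[-]-≢ (q≢x ∘ *-cancelˡ-≡ q x m)) (sym (multiplicity-[-]-≢ q≢x))

  module _ (s : ℕ) where

    Forbidden : ℕ → Set
    Forbidden k = m ∣ k × m * s < k

    forbidden? : Decidable Forbidden
    forbidden? k = m ∣? k ×-dec m * s <? k

    forbidden-* : ∀ {j} → s < j → Forbidden (m * j)
    forbidden-* {j} s<j = m∣m*n j , *-monoʳ-< m s<j

    forbidden-/ : ∀ {k} → Forbidden k → s < k / m
    forbidden-/ {k} (m∣k , ms<k) = *-cancelˡ-< m s (k / m) (subst (m * s <_) (sym (m*[n/m]≡n m∣k)) ms<k)

    forbidden-/-< : ∀ {k} → Forbidden k → k / m < k
    forbidden-/-< {k} fb@(m∣k , _) = subst (k / m <_) (trans (*-comm (k / m) m) (m*[n/m]≡n m∣k))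
      (m<m*n (k / m) m {{>-nonZero (≤-<-trans z≤n (forbidden-/ fb))}} 1<m)

    forbidden-> : ∀ {k} → Forbidden k → s < k
    forbidden-> (_ , ms<k) = ≤-<-trans (m≤n*m _ m) ms<k

    data Region (k : ℕ) : Set where
      low : k ≤ s → Region k
      forbidden : Forbidden k → Region k
      free : s < k → ¬ Forbidden k → Region k

    region : ∀ k → Region k
    region k with k ≤? s | forbidden? k
    ... | yes k≤s | _ = low k≤s
    ... | no _ | yes fb = forbidden fb
    ... | no k≰s | no ¬fb = free (≰⇒> k≰s) ¬fb

    data Chain : ℕ → Set where
      root : ∀ {r} → ¬ Forbidden r → Chain r
      step : ∀ {j} → s < j → Chain j → Chain (m * j)

    chain : ∀ k → Chain k
    chain k = descend (<-wellFounded k)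
      where
      descend : ∀ {k} → Acc _<_ k → Chain k
      descend {k} (acc smaller) with forbidden? k
      ... | no ¬fb = root ¬fb
      ... | yes fb = subst Chain (m*[n/m]≡n (proj₁ fb))
        (step (forbidden-/ fb) (descend (smaller (forbidden-/-< fb))))

    -- For r not forbidden, quotient a (mᵈ r) = ⌊a r / mᵈ⌋, whose last base-m digit is
    -- merge a (mᵈ r); the fuel k suffices since d ≤ k.
    quotientWithin : ℕ → (ℕ → ℕ) → ℕ → ℕ
    quotientWithin zero a k = a k
    quotientWithin (suc f) a k with forbidden? k
    ... | yes _ = quotientWithin f a (k / m) / m
    ... | no _ = a k

    quotient : (ℕ → ℕ) → ℕ → ℕ
    quotient a k = quotientWithin k a k

    quotientWithin-0 : ∀ a f → quotientWithin f a 0 ≡ a 0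
    quotientWithin-0 a zero = refl
    quotientWithin-0 a (suc f) with forbidden? 0
    ... | yes fb = contradiction (forbidden-> fb) λ ()
    ... | no _ = refl

    quotientWithin-fuel : ∀ a f g {k} → k ≤ f → k ≤ g → quotientWithin f a k ≡ quotientWithin g a k
    quotientWithin-fuel a zero g z≤n _ = sym (quotientWithin-0 a g)
    quotientWithin-fuel a (suc f) zero _ z≤n = quotientWithin-0 a (suc f)
    quotientWithin-fuel a (suc f) (suc g) {k} k≤f k≤g with forbidden? k
    ... | no _ = refl
    ... | yes fb = cong (_/ m) (quotientWithin-fuel a f g (descent k≤f) (descent k≤g))
      where
      descent : ∀ {h} → k ≤ suc h → k / m ≤ h
      descent k≤h = ≤-pred (<-≤-trans (forbidden-/-< fb) k≤h)

    quotient-root : ∀ a {k} → ¬ Forbidden k → quotient a k ≡ a k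
    quotient-root a {zero} _ = refl
    quotient-root a {suc k} ¬fb with forbidden? (suc k)
    ... | yes fb = contradiction fb ¬fb
    ... | no _ = refl

    quotient-forbidden : ∀ a {k} → Forbidden k → quotient a k ≡ quotient a (k / m) / m
    quotient-forbidden a {zero} fb = contradiction (forbidden-> fb) λ ()
    quotient-forbidden a {suc k} fb with forbidden? (suc k)
    ... | no ¬fb = contradiction fb ¬fb
    ... | yes _ = cong (_/ m) (quotientWithin-fuel a k (suc k / m) (≤-pred (forbidden-/-< fb)) ≤-refl)

    quotient-step : ∀ a {j} → s < j → quotient a (m * j) ≡ quotient a j / m
    quotient-step a {j} s<j =
      trans (quotient-forbidden a (forbidden-* s<j)) (cong (λ i → quotient a i / m) (m*j/m≡j j))

    quotientWithin-cong : ∀ {a a′} → a ≗ a′ → ∀ f k → quotientWithin f a k ≡ quotientWithin f a′ k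
    quotientWithin-cong a≗a′ zero k = a≗a′ k
    quotientWithin-cong a≗a′ (suc f) k with forbidden? k
    ... | yes _ = cong (_/ m) (quotientWithin-cong a≗a′ f (k / m))
    ... | no _ = a≗a′ k

    merge : (ℕ → ℕ) → ℕ → ℕ
    merge a k = quotient a k % m

    merge-cong : ∀ {a a′} → a ≗ a′ → merge a ≗ merge a′
    merge-cong a≗a′ k = cong (_% m) (quotientWithin-cong a≗a′ k k)

    merge<m : ∀ a k → merge a k < m
    merge<m a k = m%n<n (quotient a k) m

    merge-low : ∀ a {k} → k ≤ s → a k < m → merge a k ≡ a k
    merge-low a k≤s ak<m =
      trans (cong (_% m) (quotient-root a λ fb → <⇒≱ (forbidden-> fb) k≤s)) (m<n⇒m%n≡m ak<m)

    *-quotient≤ : ∀ {n} a → (∀ k → k * a k ≤ n) → ∀ k → k * quotient a k ≤ n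
    *-quotient≤ {n} a a≤ k = along (chain k)
      where
      along : ∀ {k} → Chain k → k * quotient a k ≤ n
      along {k} (root ¬fb) = subst (λ q → k * q ≤ n) (sym (quotient-root a ¬fb)) (a≤ k)
      along (step {j} s<j c) = begin
        m * j * quotient a (m * j)        ≡⟨ cong (m * j *_) (quotient-step a s<j) ⟩
        m * j * (quotient a j / m)        ≡⟨ reassoc m j (quotient a j / m) ⟩
        j * (m * (quotient a j / m))      ≤⟨ *-monoʳ-≤ j (m*[x/m]≤x (quotient a j)) ⟩
        j * quotient a j                  ≤⟨ along c ⟩
        n ∎
        where
        open ≤-Reasoning
        reassoc : ∀ m j q → m * j * q ≡ j * (m * q)
        reassoc = solve-∀
        m*[x/m]≤x : ∀ x → m * (x / m) ≤ x
        m*[x/m]≤x x = subst (_≤ x) (*-comm (x / m) m) (m/n*n≤m x m)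

    merge-vanishing : ∀ {n} a → (∀ k → k * a k ≤ n) → ∀ k → n < k → merge a k ≡ 0
    merge-vanishing {n} a a≤ k n<k =
      trans (cong (_% m) (small-multiple≡0 (quotient a k) (*-quotient≤ a a≤ k))) (m<n⇒m%n≡m 0<m)
      where
      small-multiple≡0 : ∀ q → k * q ≤ n → q ≡ 0
      small-multiple≡0 zero _ = refl
      small-multiple≡0 (suc q) kq≤n = contradiction (≤-trans (m≤m*n k (suc q)) kq≤n) (<⇒≱ n<k)

    expand-merge : ∀ a f {j} → s < j → quotient a j < m ^ f → expand (merge a) f j ≡ quotient a j
    expand-merge a zero _ q<1 = sym (n<1⇒n≡0 q<1)
    expand-merge a (suc f) {j} s<j q<m^1+f = begin
      quotient a j % m + m * expand (merge a) f (m * j)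
        ≡⟨ cong (λ x → quotient a j % m + m * x) (expand-merge a f (<-≤-trans s<j (m≤n*m j m)) q/m<m^f) ⟩
      quotient a j % m + m * quotient a (m * j)
        ≡⟨ cong (λ x → quotient a j % m + m * x) (quotient-step a s<j) ⟩
      quotient a j % m + m * (quotient a j / m)
        ≡⟨ x%m+m*[x/m]≡x (quotient a j) ⟩
      quotient a j ∎
      where
      open ≡-Reasoning
      q/m<m^f : quotient a (m * j) < m ^ f
      q/m<m^f = subst (_< m ^ f) (sym (quotient-step a s<j))
        (m<n*o⇒m/o<n (subst (quotient a j <_) (*-comm m (m ^ f)) q<m^1+f))

    module _ (n : ℕ) where

      split : (ℕ → ℕ) → ℕ → ℕ
      split b k with region k
      ... | low _ = b k
      ... | forbidden _ = 0
      ... | free _ _ = expand b (suc n) k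

      split-low : ∀ b {k} → k ≤ s → split b k ≡ b k
      split-low b {k} k≤s with region k
      ... | low _ = refl
      ... | forbidden fb = contradiction k≤s (<⇒≱ (forbidden-> fb))
      ... | free s<k _ = contradiction k≤s (<⇒≱ s<k)

      split-forbidden : ∀ b {k} → Forbidden k → split b k ≡ 0
      split-forbidden b {k} fb with region k
      ... | low k≤s = contradiction k≤s (<⇒≱ (forbidden-> fb))
      ... | forbidden _ = refl
      ... | free _ ¬fb = contradiction fb ¬fb

      split-free : ∀ b {k} → s < k → ¬ Forbidden k → split b k ≡ expand b (suc n) k
      split-free b {k} s<k ¬fb with region k
      ... | low k≤s = contradiction k≤s (<⇒≱ s<k)
      ... | forbidden fb = contradiction fb ¬fb
      ... | free _ _ = refl

      split-cong : ∀ {b c} → b ≗ c → split b ≗ split c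
      split-cong b≗c k with region k
      ... | low _ = b≗c k
      ... | forbidden _ = refl
      ... | free _ _ = expand-cong b≗c (suc n) k

      split-+ : ∀ b c k → split (λ j → b j + c j) k ≡ split b k + split c k
      split-+ b c k with region k
      ... | low _ = refl
      ... | forbidden _ = refl
      ... | free _ _ = expand-+ b c (suc n) k

      split-zero : split (λ _ → 0) ≗ λ _ → 0
      split-zero k with region k
      ... | low _ = refl
      ... | forbidden _ = refl
      ... | free s<k _ = expand-vanishing {B = 0} (λ _ _ → refl) (suc n) (≤-<-trans z≤n s<k)

      split-vanishing : ∀ {b} → (∀ j → n < j → b j ≡ 0) → ∀ k → n < k → split b k ≡ 0
      split-vanishing b-above k n<k with region k
      ... | low _ = b-above k n<k
      ... | forbidden _ = refl
      ... | free _ _ = expand-vanishing b-above (suc n) n<k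

      quotient-split : ∀ {b} → (∀ j → b j < m) → (∀ j → n < j → b j ≡ 0) →
        ∀ {k} → s < k → quotient (split b) k ≡ expand b (suc n) k
      quotient-split {b} b<m b-above {k} = along (chain k)
        where
        along : ∀ {k} → Chain k → s < k → quotient (split b) k ≡ expand b (suc n) k
        along (root ¬fb) s<k = trans (quotient-root (split b) ¬fb) (split-free b s<k ¬fb)
        along (step {j} s<j c) _ = begin
          quotient (split b) (m * j)                ≡⟨ quotient-step (split b) s<j ⟩
          quotient (split b) j / m                  ≡⟨ cong (_/ m) (along c s<j) ⟩
          (b j + m * expand b n (m * j)) / m        ≡⟨ [c+m*x]/m≡x _ (b<m j) ⟩
          expand b n (m * j)
            ≡⟨ expand-saturated b-above (≤-trans (≤-<-trans z≤n s<j) (m≤n*m j m)) ⟨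
          expand b (suc n) (m * j) ∎
          where open ≡-Reasoning

      merge-split : ∀ {b} → (∀ j → b j < m) → (∀ j → n < j → b j ≡ 0) → merge (split b) ≗ b
      merge-split {b} b<m b-above k with k ≤? s
      ... | yes k≤s =
        trans (merge-low (split b) k≤s (subst (_< m) (sym (split-low b k≤s)) (b<m k))) (split-low b k≤s)
      ... | no k≰s = trans (cong (_% m) (quotient-split b<m b-above (≰⇒> k≰s))) ([c+m*x]%m≡c _ (b<m k))

      split-merge : ∀ {a} → (∀ k → Forbidden k → a k ≡ 0) → (∀ k → k ≤ s → a k < m) →
        (∀ k → k * a k ≤ n) → split (merge a) ≗ a
      split-merge {a} a-forbidden a-low a≤ k with region k
      ... | low k≤s = merge-low a k≤s (a-low k k≤s)
      ... | forbidden fb = sym (a-forbidden k fb)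
      ... | free s<k ¬fb = trans
        (expand-merge a (suc n) s<k (subst (_< m ^ suc n) (sym (quotient-root a ¬fb)) ak<m^1+n))
        (quotient-root a ¬fb)
        where
        ak<m^1+n : a k < m ^ suc n
        ak<m^1+n = ≤-<-trans (≤-trans (m≤n*m (a k) k {{>-nonZero (≤-<-trans z≤n s<k)}}) (a≤ k))
          (<-≤-trans (n<m^n n) (^-monoʳ-≤ m (n≤1+n n)))

      expand-[root]-m* : ∀ {i} → ¬ Forbidden i → ∀ f {k} → s < k →
        expand (multiplicities [ i ]) f (m * k) ≡ 0
      expand-[root]-m* {i} ¬fb f {k} s<k with m ∣? i
      ... | yes m∣i = begin
        expand (multiplicities [ i ]) f (m * k)      ≡⟨ expand-∘-* _ f k ⟩
        expand (multiplicities [ i ] ∘ (m *_)) f k   ≡⟨ expand-cong scale f k ⟩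
        expand (multiplicities [ i / m ]) f k
          ≡⟨ expand-vanishing (λ j i/m<j → multiplicity-[-]-≢ (<⇒≢ i/m<j)) f (≤-<-trans i/m≤s s<k) ⟩
        0 ∎
        where
        open ≡-Reasoning
        scale : multiplicities [ i ] ∘ (m *_) ≗ multiplicities [ i / m ]
        scale x = trans (cong (λ i → multiplicity (m * x) [ i ]) (sym (m*[n/m]≡n m∣i)))
          (multiplicity-*-[*] (i / m) x)
        i/m≤s : i / m ≤ s
        i/m≤s = *-cancelˡ-≤ m
          (subst (_≤ m * s) (sym (m*[n/m]≡n m∣i)) (≮⇒≥ λ ms<i → ¬fb (m∣i , ms<i)))
      ... | no ¬m∣i = trans (expand-∘-* _ f k) (expand-vanishing {B = 0}
        (λ j _ → multiplicity-[-]-≢ λ i≡mj → ¬m∣i (subst (m ∣_) (sym i≡mj) (m∣m*n j)))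
        f (≤-<-trans z≤n s<k))

      split-single-root : ∀ {i} → ¬ Forbidden i → split (multiplicities [ i ]) ≗ multiplicities [ i ]
      split-single-root {i} ¬fb k with region k
      ... | low _ = refl
      ... | forbidden fb = sym (multiplicity-[-]-≢ λ i≡k → ¬fb (subst Forbidden (sym i≡k) fb))
      ... | free s<k _ = trans (cong (λ x → multiplicity k [ i ] + m * x) (expand-[root]-m* ¬fb n s<k))
        (trans (cong (multiplicity k [ i ] +_) (*-zeroʳ m)) (+-identityʳ _))

      split-single-step : ∀ {j} → s < j → j ≤ n →
        ∀ k → split (multiplicities [ m * j ]) k ≡ m * split (multiplicities [ j ]) k
      split-single-step {j} s<j j≤n k with region k
      ... | low k≤s = trans (multiplicity-[-]-≢ (>⇒≢ (<-≤-trans k<j (m≤n*m j m))))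
        (sym (trans (cong (m *_) (multiplicity-[-]-≢ (>⇒≢ k<j))) (*-zeroʳ m)))
        where
        k<j : k < j
        k<j = ≤-<-trans k≤s s<j
      ... | forbidden _ = sym (*-zeroʳ m)
      ... | free s<k ¬fb = begin
        multiplicity k [ m * j ] + m * expand (multiplicities [ m * j ]) n (m * k)
          ≡⟨ cong₂ (λ x y → x + m * y)
                   (multiplicity-[-]-≢ λ mj≡k → ¬fb (subst Forbidden mj≡k (forbidden-* s<j)))
                   (trans (expand-∘-* _ n k) (expand-cong (multiplicity-*-[*] j) n k)) ⟩
        m * expand (multiplicities [ j ]) n k
          ≡⟨ cong (m *_) (expand-saturated (λ x n<x → multiplicity-[-]-≢ (<⇒≢ (≤-<-trans j≤n n<x)))
                                            (≤-<-trans z≤n s<k)) ⟨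
        m * expand (multiplicities [ j ]) (suc n) k ∎
        where open ≡-Reasoning

      weight-split-single : ∀ {i} → 1 ≤ i → i ≤ n → weight n (split (multiplicities [ i ])) ≡ i
      weight-split-single {i} = along (chain i)
        where
        along : ∀ {i} → Chain i → 1 ≤ i → i ≤ n → weight n (split (multiplicities [ i ])) ≡ i
        along (root ¬fb) 1≤i i≤n = trans (weight-cong n (split-single-root ¬fb)) (weight-single n 1≤i i≤n)
        along (step {j} s<j c) _ mj≤n = begin
          weight n (split (multiplicities [ m * j ]))         ≡⟨ weight-cong n (split-single-step s<j j≤n) ⟩
          weight n (λ k → m * split (multiplicities [ j ]) k) ≡⟨ weight-* n m _ ⟩
          m * weight n (split (multiplicities [ j ]))         ≡⟨ cong (m *_) (along c (≤-<-trans z≤n s<j) j≤n) ⟩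
          m * j ∎
          where
          open ≡-Reasoning
          j≤n : j ≤ n
          j≤n = ≤-trans (m≤n*m j m) mj≤n

      weight-split-multiplicities : ∀ xs → PartsIn n xs → weight n (split (multiplicities xs)) ≡ sum xs
      weight-split-multiplicities [] _ = trans (weight-cong n split-zero) (weight-zero n)
      weight-split-multiplicities (x ∷ xs) ((1≤x , x≤n) ∷ inN) = begin
        weight n (split (multiplicities (x ∷ xs)))
          ≡⟨ weight-cong n (λ k → trans (split-cong (λ j → multiplicity-++ j [ x ] xs) k)
                                         (split-+ _ _ k)) ⟩
        weight n (λ k → split (multiplicities [ x ]) k + split (multiplicities xs) k)
          ≡⟨ weight-+ n _ _ ⟩
        weight n (split (multiplicities [ x ])) + weight n (split (multiplicities xs))
          ≡⟨ cong₂ _+_ (weight-split-single 1≤x x≤n) (weight-split-multiplicities xs inN) ⟩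
        x + sum xs ∎
        where open ≡-Reasoning

      weight-split : ∀ {b} → b 0 ≡ 0 → (∀ j → n < j → b j ≡ 0) → weight n (split b) ≡ weight n b
      weight-split {b} b0≡0 b-above = begin
        weight n (split b)
          ≡⟨ weight-cong n (split-cong (sym ∘ multiplicities-fromMultiplicities n b b0≡0 b-above)) ⟩
        weight n (split (multiplicities (fromMultiplicities n b)))
          ≡⟨ weight-split-multiplicities _ (fromMultiplicities-partsIn n b) ⟩
        sum (fromMultiplicities n b)
          ≡⟨ sum-fromMultiplicities n b ⟩
        weight n b ∎
        where open ≡-Reasoning

-- The bijection

module Correspondence (m : ℕ) (1<m : 1 < m) (n : ℕ) (1≤n : 1 ≤ n) where
  open Glaisher m 1<m

  merge-multiplicities : ∀ {s a} → IsPartitionMultiplicities n s a → a s < m →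
    (∀ k → Forbidden s k → a k ≡ 0) → IsPartitionMultiplicities n s (merge s a)
  merge-multiplicities {s} {a} A as<m a-forbidden = record
    { 1≤s = 1≤s
    ; vanishing-below = λ k k<s → trans (merge-low′ (<⇒≤ k<s)) (vanishing-below k k<s)
    ; smallest≢0 = smallest≢0 ∘ trans (sym (merge-low′ ≤-refl))
    ; vanishing-above = merge-vanishing s a *-bounded
    ; weight≡n = begin
        weight n (merge s a)
          ≡⟨ weight-split s n (trans (merge-low′ z≤n) vanishing-0) (merge-vanishing s a *-bounded) ⟨
        weight n (split s n (merge s a))
          ≡⟨ weight-cong n (split-merge s n a-forbidden (bounded-≤s as<m) *-bounded) ⟩
        weight n a                         ≡⟨ weight≡n ⟩
        n ∎
    }
    where
    open IsPartitionMultiplicities A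
    open ≡-Reasoning
    merge-low′ : ∀ {k} → k ≤ s → merge s a k ≡ a k
    merge-low′ {k} k≤s = merge-low s a k≤s (bounded-≤s as<m k k≤s)

  split-multiplicities : ∀ {s b} → IsPartitionMultiplicities n s b → IsPartitionMultiplicities n s (split s n b)
  split-multiplicities {s} {b} B = record
    { 1≤s = 1≤s
    ; vanishing-below = λ k k<s → trans (split-low s n b (<⇒≤ k<s)) (vanishing-below k k<s)
    ; smallest≢0 = smallest≢0 ∘ trans (sym (split-low s n b ≤-refl))
    ; vanishing-above = split-vanishing s n vanishing-above
    ; weight≡n = trans (weight-split s n vanishing-0 vanishing-above) weight≡n
    }
    where open IsPartitionMultiplicities B

  leftCondition⇒ : ∀ xs → LeftCondition m xs →
    ∀ k → Forbidden (smallestPart xs) k → multiplicity k xs ≡ 0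
  leftCondition⇒ xs (_ , bounded) k (m∣k , ms<k) =
    multiplicity-∉ xs λ k∈ → <⇒≱ ms<k (All.lookup bounded (∈-filter⁺ (m ∣?_) k∈ m∣k))

  ⇒leftCondition : ∀ xs {s} → smallestPart xs ≡ s → multiplicity s xs < m →
    (∀ k → Forbidden s k → multiplicity k xs ≡ 0) → LeftCondition m xs
  ⇒leftCondition xs refl ms<m forbidden≡0 = ms<m , All.tabulate λ k∈filter →
    let (k∈ , m∣k) = ∈-filter⁻ (m ∣?_) {xs = xs} k∈filter
    in ≮⇒≥ λ ms<k → ∈⇒multiplicity≢0 k∈ (forbidden≡0 _ (m∣k , ms<k))

  rightCondition⇒ : ∀ xs → RightCondition m xs → ∀ k → multiplicity k xs < m
  rightCondition⇒ xs bounded k with k ∈? xs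
  ... | yes k∈ = All.lookup bounded k∈
  ... | no k∉ = subst (_< m) (sym (multiplicity-∉ xs k∉)) 0<m

  toRight : List ℕ → List ℕ
  toRight xs = fromMultiplicities n (merge (smallestPart xs) (multiplicities xs))

  toLeft : List ℕ → List ℕ
  toLeft ys = fromMultiplicities n (split (smallestPart ys) n (multiplicities ys))

  toRight-multiplicities : ∀ {xs} → IsPartition n xs → LeftCondition m xs →
    IsPartitionMultiplicities n (smallestPart xs) (merge (smallestPart xs) (multiplicities xs))
  toRight-multiplicities {xs} isP lc =
    merge-multiplicities (partition-multiplicities 1≤n isP) (proj₁ lc) (leftCondition⇒ xs lc)

  toLeft-multiplicities : ∀ {ys} → IsPartition n ys →
    IsPartitionMultiplicities n (smallestPart ys) (split (smallestPart ys) n (multiplicities ys))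
  toLeft-multiplicities isP = split-multiplicities (partition-multiplicities 1≤n isP)

  toRight-correct : ∀ {xs} → IsPartition n xs → LeftCondition m xs →
    IsPartition n (toRight xs) × RightCondition m (toRight xs)
  toRight-correct {xs} isP lc = isPartition , All.tabulate λ {k} _ →
    subst (_< m) (sym (multiplicities-≗ k)) (merge<m (smallestPart xs) (multiplicities xs) k)
    where open IsPartitionMultiplicities (toRight-multiplicities isP lc)

  toLeft-correct : ∀ {ys} → IsPartition n ys → RightCondition m ys →
    IsPartition n (toLeft ys) × LeftCondition m (toLeft ys)
  toLeft-correct {ys} isP rc = isPartition ,
    ⇒leftCondition (toLeft ys) smallestPart-≡
      (subst (_< m) (sym (trans (multiplicities-≗ s) (split-low s n b ≤-refl))) (rightCondition⇒ ys rc s))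
      (λ k fb → trans (multiplicities-≗ k) (split-forbidden s n b fb))
    where
    s = smallestPart ys
    b = multiplicities ys
    open IsPartitionMultiplicities (toLeft-multiplicities isP)

  toLeft-toRight : ∀ {xs} → IsPartition n xs → LeftCondition m xs → toLeft (toRight xs) ≡ xs
  toLeft-toRight {xs} isP lc = begin
    fromMultiplicities n (split (smallestPart (toRight xs)) n (multiplicities (toRight xs)))
      ≡⟨ cong (λ s → fromMultiplicities n (split s n (multiplicities (toRight xs)))) M.smallestPart-≡ ⟩
    fromMultiplicities n (split s n (multiplicities (toRight xs)))
      ≡⟨ fromMultiplicities-cong n (λ k _ → trans (split-cong s n M.multiplicities-≗ k)
           (split-merge s n (leftCondition⇒ xs lc) (A.bounded-≤s (proj₁ lc)) A.*-bounded k)) ⟩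
    fromMultiplicities n (multiplicities xs)
      ≡⟨ partition-fromMultiplicities-multiplicities isP ⟩
    xs ∎
    where
    open ≡-Reasoning
    s = smallestPart xs
    module A = IsPartitionMultiplicities (partition-multiplicities 1≤n isP)
    module M = IsPartitionMultiplicities (toRight-multiplicities isP lc)

  toRight-toLeft : ∀ {ys} → IsPartition n ys → RightCondition m ys → toRight (toLeft ys) ≡ ys
  toRight-toLeft {ys} isP rc = begin
    fromMultiplicities n (merge (smallestPart (toLeft ys)) (multiplicities (toLeft ys)))
      ≡⟨ cong (λ s → fromMultiplicities n (merge s (multiplicities (toLeft ys)))) S.smallestPart-≡ ⟩
    fromMultiplicities n (merge s (multiplicities (toLeft ys)))
      ≡⟨ fromMultiplicities-cong n (λ k _ → trans (merge-cong s S.multiplicities-≗ k)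
           (merge-split s n (rightCondition⇒ ys rc) B.vanishing-above k)) ⟩
    fromMultiplicities n (multiplicities ys)
      ≡⟨ partition-fromMultiplicities-multiplicities isP ⟩
    ys ∎
    where
    open ≡-Reasoning
    s = smallestPart ys
    module B = IsPartitionMultiplicities (partition-multiplicities 1≤n isP)
    module S = IsPartitionMultiplicities (toLeft-multiplicities isP)

theorem5 : (m n : ℕ) → 2 ≤ m → 1 ≤ n →
    (Σ (Partition n) (λ p → LeftCondition m (proj₁ p)))
      ↔ (Σ (Partition n) (λ p → RightCondition m (proj₁ p)))
theorem5 m n 2≤m 1≤n = partitionClasses-↔ (leftCondition-irrelevant m) (rightCondition-irrelevant m)
  toRight toLeft toRight-correct toLeft-correct toLeft-toRight toRight-toLeft
  where open Correspondence m 2≤m n 1≤n
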